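{- Let $A$ be a finite set of agents with $|A|\ge2$. The auxiliary canonical structure $M^{\ast c}$ is an auxiliary-colour simplicial secrecy model over $A$.
   Context: The language $\mathcal{L}_{KS}$ over a countable set $\mathsf{Prop}$ of variables and agents $A$ is $\varphi::=p\mid\neg\varphi\mid(\varphi\wedge\varphi)\mid K_a\varphi\mid S_a\varphi$. The system $\mathsf{SSL}$ has axioms: all propositional tautologies; for each $a\in A$: (K) $K_a(\varphi\to\psi)\to(K_a\varphi\to K_a\psi)$, (T) $K_a\varphi\to\varphi$, (4) $K_a\varphi\to K_aK_a\varphi$, (5) $\neg K_a\varphi\to K_a\neg K_a\varphi$, (S1) $S_a\varphi\to K_a\varphi$, (S4) $S_a\varphi\to K_aS_a\varphi$; for distinct $a,b$: (S2) $S_a\varphi\to\neg K_b\varphi$. Rules: modus ponens; from $\varphi$ infer $K_a\varphi$; from $\vdash\varphi\leftrightarrow\psi$ infer $\vdash S_a\varphi\leftrightarrow S_a\psi$. $\mathsf{MCS}$ is the set of maximally $\mathsf{SSL}$-consistent sets. For $\Gamma,\Delta\in\mathsf{MCS}$: $\Gamma R_a\Delta$ iff $\{\varphi:K_a\varphi\in\Gamma\}\subseteq\Delta$; $[\Gamma]_a=\{\Delta:\Gamma R_a\Delta\}$. Auxiliary canonical model $M^{\ast c}$ (fresh colour $\ast\notin A$): vertices $(\ast,\Gamma)$ and $(a,[\Gamma]_a)$; facets $X^\ast_\Gamma=\{(\ast,\Gamma)\}\cup\{(a,[\Gamma]_a):a\in A\}$, faces their downward closure; colouring $(\ast,\Gamma)\mapsto\ast$,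 $(a,[\Gamma]_a)\mapsto a$; valuation $\nu(X^\ast_\Gamma)=\mathsf{Prop}\cap\Gamma$; for $v=(a,[\Gamma]_a)$, $N_a^{S}(v)=\{\widehat{\varphi}^\ast:S_a\varphi\in\Gamma\}$, $\widehat{\varphi}^\ast=\{X^\ast_\Delta:\varphi\in\Delta\}$. An auxiliary-colour simplicial secrecy model over $A$ is $(V,\mathcal{F},\chi,\nu,\{N_a^S\}_{a\in A})$ where $\mathcal{F}$ is a non-empty downward-closed family of finite non-empty subsets of $V$, $\chi:V\to A\cup\{\ast\}$ is injective on faces, every facet (maximal face) has colour set $A\cup\{\ast\}$, every vertex lies in a facet, $\nu$ maps facets to $\mathcal{P}(\mathsf{Prop})$, and each $N_a^S$ maps colour-$a$ vertices to sets of sets of facets satisfying (SN): for all $v$ of colour $a$, $U\in N_a^S(v)$, facets $X\ni v$, and $b\in A\setminus\{a\}$, there is a facet $Y$ with the same colour-$b$ vertex as $X$ and $Y\notin U$. -}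

module Defs where

open import Level using (Level; _⊔_) renaming (suc to lsuc; zero to lzero)
open import Data.Nat using (ℕ)
open import Data.Fin using (Fin)
open import Data.Bool using (Bool; true; not; _∧_)
open import Data.List using (List; []; _∷_; map; allFin)
open import Data.List.Relation.Unary.All using (All)
open import Data.List.Relation.Unary.Any using (Any)
open import Data.Product using (Σ; _×_; _,_)
open import Data.Sum using (_⊎_)
open import Data.Empty.Polymorphic using (⊥)
open import Relation.Nullary using (¬_)
open import Relation.Binary.PropositionalEquality using (_≡_; _≢_)
open import Relation.Binary.Structures using (IsEquivalence)
open import Function.Bundles using (_⇔_)

infix 8 ¬'_
infixr 6 _∧'_
data Form (n : ℕ) : Set where
  var  : ℕ → Form n
  ¬'_  : Form n → Form n
  _∧'_ : Form n → Form n → Form n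
  K    : Fin n → Form n → Form n
  S    : Fin n → Form n → Form n

module _ {n : ℕ} where

  infixr 4 _⇒'_
  infix 3 _⇔'_
  _⇒'_ : Form n → Form n → Form n
  φ ⇒' ψ = ¬' (φ ∧' ¬' ψ)

  _⇔'_ : Form n → Form n → Form n
  φ ⇔' ψ = (φ ⇒' ψ) ∧' (ψ ⇒' φ)

  ⊤' : Form n
  ⊤' = ¬' (var 0 ∧' ¬' var 0)

  evalB : (Form n → Bool) → Form n → Bool
  evalB v (var p)  = v (var p)
  evalB v (¬' φ)   = not (evalB v φ)
  evalB v (φ ∧' ψ) = evalB v φ ∧ evalB v ψ
  evalB v (K a φ)  = v (K a φ)
  evalB v (S a φ)  = v (S a φ)

  Tautology : Form n → Set
  Tautology φ = (v : Form n → Bool) → evalB v φ ≡ true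

  data ⊢_ : Form n → Set where
    taut  : ∀ {φ} → Tautology φ → ⊢ φ
    axK   : ∀ a φ ψ → ⊢ (K a (φ ⇒' ψ) ⇒' (K a φ ⇒' K a ψ))
    axT   : ∀ a φ → ⊢ (K a φ ⇒' φ)
    ax4   : ∀ a φ → ⊢ (K a φ ⇒' K a (K a φ))
    ax5   : ∀ a φ → ⊢ (¬' K a φ ⇒' K a (¬' K a φ))
    axS1  : ∀ a φ → ⊢ (S a φ ⇒' K a φ)
    axS4  : ∀ a φ → ⊢ (S a φ ⇒' K a (S a φ))
    axS2  : ∀ a b φ → a ≢ b → ⊢ (S a φ ⇒' ¬' K b φ)
    mp    : ∀ {φ ψ} → ⊢ (φ ⇒' ψ) → ⊢ φ → ⊢ ψ
    nec   : ∀ a {φ} → ⊢ φ → ⊢ K a φ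
    sre   : ∀ a {φ ψ} → ⊢ (φ ⇔' ψ) → ⊢ (S a φ ⇔' S a ψ)

  FSet : Set₁
  FSet = Form n → Set

  conj : List (Form n) → Form n
  conj []      = ⊤'
  conj (φ ∷ L) = φ ∧' conj L

  Consistent : FSet → Set
  Consistent Γ = ¬ (Σ (List (Form n)) λ L → All Γ L × ⊢ (¬' conj L))

  _⊆F_ : FSet → FSet → Set
  Γ ⊆F Δ = ∀ φ → Γ φ → Δ φ

  IsMCS : FSet → Set₁
  IsMCS Γ = Consistent Γ × (∀ (Δ : FSet) → Γ ⊆F Δ → Consistent Δ → Δ ⊆F Γ)

  MCS : Set₁
  MCS = Σ FSet IsMCS

  _∋_ : MCS → Form n → Set
  (Γ , _) ∋ φ = Γ φ

  R : Fin n → MCS → MCS → Set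
  R a Γ Δ = ∀ φ → Γ ∋ K a φ → Δ ∋ φ

data Col (n : ℕ) : Set where
  ∗  : Col n
  ag : Fin n → Col n

-- Auxiliary-colour simplicial secrecy models.
-- Vertices form a type V with an equivalence relation _≈_ (identity of
-- vertices); finite subsets of V are lists read as sets up to _≈_.

module _ {ℓ : Level} {V : Set ℓ} (_≈_ : V → V → Set ℓ) where

  _∈ₛ_ : V → List V → Set ℓ
  x ∈ₛ X = Any (x ≈_) X

  _⊆ₛ_ : List V → List V → Set ℓ
  X ⊆ₛ Y = ∀ x → x ∈ₛ X → x ∈ₛ Y

  _≈ₛ_ : List V → List V → Set ℓ
  X ≈ₛ Y = (X ⊆ₛ Y) × (Y ⊆ₛ X)

  NonEmpty : List V → Set ℓ
  NonEmpty X = Σ V λ x → x ∈ₛ X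

record IsSecrecyModel {ℓ : Level} (n : ℕ) (V : Set ℓ) (_≈_ : V → V → Set ℓ)
         (F : List V → Set ℓ) (χ : V → Col n) (ν : List V → ℕ → Set ℓ)
         (N : Fin n → V → (List V → Set ℓ) → Set ℓ) : Set (lsuc ℓ) where
  IsFacet : List V → Set ℓ
  IsFacet X = F X × (∀ Y → F Y → _⊆ₛ_ _≈_ X Y → _⊆ₛ_ _≈_ Y X)
  field
    ≈-equiv      : IsEquivalence _≈_
    F-nonempty   : Σ (List V) F
    F-faces      : ∀ X → F X → NonEmpty _≈_ X
    F-down       : ∀ X Y → F X → _⊆ₛ_ _≈_ Y X → NonEmpty _≈_ Y → F Y
    χ-resp       : ∀ x y → x ≈ y → χ x ≡ χ y
    χ-inj        : ∀ X → F X → ∀ x y → _∈ₛ_ _≈_ x X → _∈ₛ_ _≈_ y X → χ x ≡ χ y → x ≈ y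
    facet-cols   : ∀ X → IsFacet X → ∀ (c : Col n) → Σ V λ x → _∈ₛ_ _≈_ x X × χ x ≡ c
    vert-facet   : ∀ v → Σ (List V) λ X → IsFacet X × _∈ₛ_ _≈_ v X
    ν-resp       : ∀ X Y → IsFacet X → IsFacet Y → _≈ₛ_ _≈_ X Y → ∀ p → ν X p → ν Y p
    N-resp       : ∀ a v w → χ v ≡ ag a → v ≈ w → ∀ U → N a v U → N a w U
    N-facets     : ∀ a v → χ v ≡ ag a → ∀ U → N a v U → ∀ X → U X → IsFacet X
    SN           : ∀ a v → χ v ≡ ag a → ∀ U → N a v U → ∀ X → IsFacet X → _∈ₛ_ _≈_ v X →
                   ∀ b → b ≢ a →
                   Σ (List V) λ Y → IsFacet Y ×
                     (Σ V λ w → _∈ₛ_ _≈_ w X × _∈ₛ_ _≈_ w Y × χ w ≡ ag b) × ¬ U Y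

module Canonical (n : ℕ) where

  -- (∗ , Γ)  and  (a , [Γ]_a)  (the latter represented by a witness Γ)
  data CV : Set₁ where
    starV : MCS {n} → CV
    agV   : Fin n → MCS {n} → CV

  data _≈c_ : CV → CV → Set₁ where
    star≈ : ∀ {Γ Δ} → (∀ φ → (Γ ∋ φ) ⇔ (Δ ∋ φ)) → starV Γ ≈c starV Δ
    ag≈   : ∀ {a Γ Δ} → (∀ Θ → R a Γ Θ ⇔ R a Δ Θ) → agV a Γ ≈c agV a Δ

  Xs : MCS {n} → List CV
  Xs Γ = starV Γ ∷ map (λ a → agV a Γ) (allFin n)

  Fc : List CV → Set₁
  Fc X = NonEmpty _≈c_ X × Σ (MCS {n}) λ Γ → _⊆ₛ_ _≈c_ X (Xs Γ)

  χc : CV → Col n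
  χc (starV _) = ∗
  χc (agV a _) = ag a

  νc : List CV → ℕ → Set₁
  νc X p = Σ (MCS {n}) λ Γ → _≈ₛ_ _≈c_ X (Xs Γ) × (Γ ∋ var p)

  hat : Form n → List CV → Set₁
  hat φ X = Σ (MCS {n}) λ Δ → _≈ₛ_ _≈c_ X (Xs Δ) × (Δ ∋ φ)

  Nc : Fin n → CV → (List CV → Set₁) → Set₁
  Nc a (starV _) U = ⊥
  Nc a (agV _ Γ) U = Σ (Form n) λ φ → (Γ ∋ S a φ) × (∀ X → U X ⇔ hat φ X)

-- Vertices (a,[Γ]_a) are classes of R_a, an equivalence relation by T, 4 and 5,
-- and S_a φ is constant on each class by S4; this makes N^S_a well defined.  For
-- (SN): if (a,[Γ]_a) lies on the facet X^∗_Θ and S_a φ ∈ Γ, then S_a φ ∈ Θ, so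
-- ¬K_b φ ∈ Θ by S2 and the existence lemma gives Δ with Θ R_b Δ and ¬φ ∈ Δ.  The
-- facet X^∗_Δ shares the colour-b vertex [Θ]_b = [Δ]_b with X^∗_Θ and is not in φ̂^∗.
module Submission where

open import Defs
open import Data.Bool using (Bool; true; false; not; _∧_; T)
open import Data.Bool.Properties using (T-≡; T-∧)
open import Data.Empty using (⊥)
open import Data.Fin using (Fin)
open import Data.List using (List; []; _∷_; _++_; map; allFin; cartesianProductWith)
open import Data.List.Membership.Propositional using (_∈_)
open import Data.List.Membership.Propositional.Properties
  using (∈-++⁺ˡ; ∈-++⁺ʳ; ∈-map⁺; ∈-allFin; ∈-cartesianProductWith⁺)
open import Data.List.Relation.Unary.All using (All; []; _∷_)
open import Data.List.Relation.Unary.Any using (here; there)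
import Data.List.Relation.Unary.Any as Any
open import Data.List.Relation.Unary.Any.Properties using (map⁺; map⁻)
import Data.List.Relation.Unary.All as All
import Data.List.Relation.Unary.All.Properties as AllP
open import Data.Nat using (ℕ; zero; suc; _≤_; _⊔_; _≤′_; ≤′-refl; ≤′-step)
open import Data.Nat.Properties using (m≤m⊔n; m≤n⊔m; ≤⇒≤′)
open import Data.Product using (Σ; Σ-syntax; ∃-syntax; _×_; _,_; proj₁; proj₂)
open import Data.Sum using (_⊎_; inj₁; inj₂)
open import Data.Unit using (tt)
open import Function using (_∘_)
open import Function.Bundles using (_⇔_; mk⇔; Equivalence)
open import Function.Properties.Equivalence using (⇔-isEquivalence)
open import Relation.Nullary using (¬_)
open import Relation.Nullary.Decidable using (T?; decidable-stable)
open import Relation.Binary.PropositionalEquality using (_≡_; _≢_; refl; sym; subst)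
open import Relation.Binary.Structures using (IsEquivalence)

open Equivalence using (to; from)

T-not : ∀ {x} → T (not x) ⇔ (¬ T x)
T-not {true}  = mk⇔ (λ ()) (λ f → f tt)
T-not {false} = mk⇔ (λ _ ()) (λ _ → tt)

T-⇒ : ∀ {x y} → T (not (x ∧ not y)) ⇔ (T x → T y)
T-⇒ {true}  {true}  = mk⇔ (λ _ _ → tt) (λ _ → tt)
T-⇒ {true}  {false} = mk⇔ (λ ()) (λ f → f tt)
T-⇒ {false}         = mk⇔ (λ _ ()) (λ _ → tt)

self-implication : ∀ x → T (not (x ∧ not x))
self-implication x = from (T-⇒ {x} {x}) (λ p → p)

module _ {n : ℕ} where

  Valuation : Set
  Valuation = Form n → Bool

  infix 4 _⊨_
  record _⊨_ (v : Valuation) (φ : Form n) : Set where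
    constructor holds
    field evaluates-true : T (evalB v φ)
  open _⊨_

  ⊨-¬ : ∀ {v φ} → v ⊨ ¬' φ ⇔ (¬ (v ⊨ φ))
  ⊨-¬ = mk⇔ (λ p q → to T-not (evaluates-true p) (evaluates-true q))
            (λ f → holds (from T-not (f ∘ holds)))

  ⊨-∧ : ∀ {v φ ψ} → v ⊨ φ ∧' ψ ⇔ ((v ⊨ φ) × (v ⊨ ψ))
  ⊨-∧ = mk⇔ (λ p → let (q , r) = to T-∧ (evaluates-true p) in holds q , holds r)
            (λ { (holds q , holds r) → holds (from T-∧ (q , r)) })

  ⊨-⇒ : ∀ {v φ ψ} → v ⊨ (φ ⇒' ψ) ⇔ (v ⊨ φ → v ⊨ ψ)
  ⊨-⇒ = mk⇔ (λ p q → holds (to T-⇒ (evaluates-true p) (evaluates-true q)))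
            (λ f → holds (from T-⇒ (evaluates-true ∘ f ∘ holds)))

  ⊨-⊤ : ∀ {v} → v ⊨ ⊤'
  ⊨-⊤ = from ⊨-⇒ (λ p → p)

  ⊨-stable : ∀ {v φ} → ¬ ¬ (v ⊨ φ) → v ⊨ φ
  ⊨-stable {v} {φ} nn = holds (decidable-stable (T? (evalB v φ)) (λ f → nn (f ∘ evaluates-true)))

  ⊨-conj : ∀ {v} L → v ⊨ conj L ⇔ All (v ⊨_) L
  ⊨-conj []      = mk⇔ (λ _ → []) (λ _ → ⊨-⊤)
  ⊨-conj (φ ∷ L) = mk⇔
    (λ p → let (q , r) = to ⊨-∧ p in q ∷ to (⊨-conj L) r)
    (λ { (q ∷ qs) → from ⊨-∧ (q , from (⊨-conj L) qs) })

  ⊢-valid : ∀ {φ} → (∀ v → v ⊨ φ) → ⊢ φ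
  ⊢-valid h = taut (λ v → to T-≡ (evaluates-true (h v)))

  ⊢-conj : ∀ {L} → All ⊢_ L → ⊢ conj L
  ⊢-conj []                 = ⊢-valid (λ _ → ⊨-⊤)
  ⊢-conj {φ ∷ L} (p ∷ ps) = mp (mp (⊢-valid pairing) p) (⊢-conj ps)
    where
    pairing : ∀ v → v ⊨ (φ ⇒' (conj L ⇒' φ ∧' conj L))
    pairing v = from ⊨-⇒ λ q → from ⊨-⇒ λ r → from ⊨-∧ (q , r)

  ⊢-consequence : ∀ Ps {ψ} → (∀ v → All (v ⊨_) Ps → v ⊨ ψ) → All ⊢_ Ps → ⊢ ψ
  ⊢-consequence Ps h ps =
    mp (⊢-valid λ v → from ⊨-⇒ (h v ∘ to (⊨-conj Ps))) (⊢-conj ps)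

  ⊢-¬¬-elimʳ : ∀ {χ φ} → ⊢ (χ ⇒' ¬' ¬' φ) → ⊢ (χ ⇒' φ)
  ⊢-¬¬-elimʳ ⊢χ⇒¬¬φ = ⊢-consequence (_ ∷ []) eliminate (⊢χ⇒¬¬φ ∷ [])
    where
    eliminate : ∀ v → All (v ⊨_) (_ ∷ []) → v ⊨ _
    eliminate v (χ⇒¬¬φ ∷ []) = from ⊨-⇒ λ χ-holds →
      ⊨-stable (to ⊨-¬ (to ⊨-⇒ χ⇒¬¬φ χ-holds) ∘ from ⊨-¬)

  ⊢-K-conj : ∀ b {N φ} → ⊢ (conj N ⇒' φ) → ⊢ (conj (map (K b) N) ⇒' K b φ)
  ⊢-K-conj b {[]} ⊢⊤⇒φ = ⊢-consequence (_ ∷ []) weaken (nec b (mp ⊢⊤⇒φ (⊢-valid λ _ → ⊨-⊤)) ∷ [])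
    where
    weaken : ∀ v → All (v ⊨_) (_ ∷ []) → v ⊨ _
    weaken v (Kφ ∷ []) = from ⊨-⇒ λ _ → Kφ
  ⊢-K-conj b {ψ ∷ N} {φ} ⊢ψN⇒φ =
    ⊢-consequence (_ ∷ _ ∷ []) combine
      (axK b ψ φ ∷ ⊢-K-conj b {N} (⊢-consequence (_ ∷ []) curry (⊢ψN⇒φ ∷ [])) ∷ [])
    where
    curry : ∀ v → All (v ⊨_) (_ ∷ []) → v ⊨ (conj N ⇒' (ψ ⇒' φ))
    curry v (ψN⇒φ ∷ []) = from ⊨-⇒ λ N-holds → from ⊨-⇒ λ ψ-holds →
      to ⊨-⇒ ψN⇒φ (from ⊨-∧ (ψ-holds , N-holds))
    combine : ∀ v → All (v ⊨_) (_ ∷ _ ∷ []) → v ⊨ _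
    combine v (axiom ∷ KN⇒K[ψ⇒φ] ∷ []) = from ⊨-⇒ λ KψKN-holds →
      let (Kψ , KN) = to ⊨-∧ KψKN-holds
      in to ⊨-⇒ (to ⊨-⇒ axiom (to ⊨-⇒ KN⇒K[ψ⇒φ] KN)) Kψ

  -- Truth in the one-world model with K_a the identity and S_a empty; it is sound for SSL.
  ⟦_⟧₁ : Form n → Bool
  ⟦ var p ⟧₁    = false
  ⟦ ¬' φ ⟧₁     = not ⟦ φ ⟧₁
  ⟦ φ ∧' ψ ⟧₁   = ⟦ φ ⟧₁ ∧ ⟦ ψ ⟧₁
  ⟦ K a φ ⟧₁    = ⟦ φ ⟧₁
  ⟦ S a φ ⟧₁    = false

  evalB-⟦⟧₁ : ∀ φ → evalB ⟦_⟧₁ φ ≡ ⟦ φ ⟧₁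
  evalB-⟦⟧₁ (var p)  = refl
  evalB-⟦⟧₁ (¬' φ)   rewrite evalB-⟦⟧₁ φ = refl
  evalB-⟦⟧₁ (φ ∧' ψ) rewrite evalB-⟦⟧₁ φ | evalB-⟦⟧₁ ψ = refl
  evalB-⟦⟧₁ (K a φ)  = refl
  evalB-⟦⟧₁ (S a φ)  = refl

  ⟦⟧₁-sound : ∀ {φ} → ⊢ φ → T ⟦ φ ⟧₁
  ⟦⟧₁-sound {φ} (taut valid)  = subst T (evalB-⟦⟧₁ φ) (from T-≡ (valid ⟦_⟧₁))
  ⟦⟧₁-sound (axK a φ ψ)       = self-implication ⟦ φ ⇒' ψ ⟧₁
  ⟦⟧₁-sound (axT a φ)         = self-implication ⟦ φ ⟧₁
  ⟦⟧₁-sound (ax4 a φ)         = self-implication ⟦ φ ⟧₁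
  ⟦⟧₁-sound (ax5 a φ)         = self-implication ⟦ ¬' φ ⟧₁
  ⟦⟧₁-sound (axS1 a φ)        = tt
  ⟦⟧₁-sound (axS4 a φ)        = tt
  ⟦⟧₁-sound (axS2 a b φ a≢b)  = tt
  ⟦⟧₁-sound (mp ⊢φ⇒ψ ⊢φ)      = to T-⇒ (⟦⟧₁-sound ⊢φ⇒ψ) (⟦⟧₁-sound ⊢φ)
  ⟦⟧₁-sound (nec a ⊢φ)        = ⟦⟧₁-sound ⊢φ
  ⟦⟧₁-sound (sre a ⊢φ⇔ψ)      = tt

  ∅-consistent : Consistent {n} (λ _ → ⊥)
  ∅-consistent ([] , [] , ⊢¬⊤) = to T-not (⟦⟧₁-sound ⊢¬⊤) (self-implication false)

  infixl 5 _∪｛_｝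
  _∪｛_｝ : FSet {n} → Form n → FSet {n}
  (Γ ∪｛ χ ｝) ψ = Γ ψ ⊎ ψ ≡ χ

  ∪-split : ∀ {Γ χ} M → All (Γ ∪｛ χ ｝) M →
            Σ[ N ∈ List (Form n) ] All Γ N × (∀ {v} → All (v ⊨_) N → v ⊨ χ → All (v ⊨_) M)
  ∪-split []      []              = [] , [] , λ _ _ → []
  ∪-split (φ ∷ M) (inj₁ φ∈Γ ∷ M⊆) with ∪-split M M⊆
  ... | N , N⊆Γ , sem = φ ∷ N , φ∈Γ ∷ N⊆Γ , λ { (p ∷ ps) q → p ∷ sem ps q }
  ∪-split (φ ∷ M) (inj₂ refl ∷ M⊆) with ∪-split M M⊆
  ... | N , N⊆Γ , sem = N , N⊆Γ , λ ps q → q ∷ sem ps q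

  ∪-inconsistent : ∀ {Γ χ M} → All (Γ ∪｛ χ ｝) M → ⊢ (¬' conj M) →
                   Σ[ N ∈ List (Form n) ] All Γ N × ⊢ (conj N ⇒' ¬' χ)
  ∪-inconsistent {M = M} M⊆ ⊢¬M with ∪-split M M⊆
  ... | N , N⊆Γ , sem = N , N⊆Γ , ⊢-consequence (_ ∷ []) refute (⊢¬M ∷ [])
    where
    refute : ∀ v → All (v ⊨_) (¬' conj M ∷ []) → v ⊨ (conj N ⇒' ¬' _)
    refute v (¬M ∷ []) = from ⊨-⇒ λ N-holds → from ⊨-¬ λ χ-holds →
      to ⊨-¬ ¬M (from (⊨-conj M) (sem (to (⊨-conj N) N-holds) χ-holds))

  module _ (Γ : MCS {n}) where

    private
      Γ-consistent : Consistent (proj₁ Γ)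
      Γ-consistent = proj₁ (proj₂ Γ)

    mcs-absorbs : ∀ {χ} → Consistent (proj₁ Γ ∪｛ χ ｝) → Γ ∋ χ
    mcs-absorbs consistent = proj₂ (proj₂ Γ) _ (λ _ → inj₁) consistent _ (inj₂ refl)

    mcs-closed : ∀ {L ψ} → All (Γ ∋_) L → ⊢ (conj L ⇒' ψ) → Γ ∋ ψ
    mcs-closed {L} {ψ} L⊆Γ ⊢L⇒ψ = mcs-absorbs consistent
      where
      consistent : Consistent (proj₁ Γ ∪｛ ψ ｝)
      consistent (M , M⊆ , ⊢¬M) with ∪-inconsistent M⊆ ⊢¬M
      ... | N , N⊆Γ , ⊢N⇒¬ψ =
        Γ-consistent (L ++ N , AllP.++⁺ L⊆Γ N⊆Γ , ⊢-consequence (_ ∷ _ ∷ []) refute (⊢L⇒ψ ∷ ⊢N⇒¬ψ ∷ []))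
        where
        refute : ∀ v → All (v ⊨_) ((conj L ⇒' ψ) ∷ (conj N ⇒' ¬' ψ) ∷ []) → v ⊨ ¬' conj (L ++ N)
        refute v (L⇒ψ ∷ N⇒¬ψ ∷ []) = from ⊨-¬ λ LN-holds →
          let LN = to (⊨-conj (L ++ N)) LN-holds
          in to ⊨-¬ (to ⊨-⇒ N⇒¬ψ (from (⊨-conj N) (AllP.++⁻ʳ L LN)))
                    (to ⊨-⇒ L⇒ψ (from (⊨-conj L) (AllP.++⁻ˡ L LN)))

    mcs-⇒ : ∀ {φ ψ} → Γ ∋ φ → ⊢ (φ ⇒' ψ) → Γ ∋ ψ
    mcs-⇒ φ∈Γ ⊢φ⇒ψ = mcs-closed (φ∈Γ ∷ []) (⊢-consequence (_ ∷ []) detach (⊢φ⇒ψ ∷ []))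
      where
      detach : ∀ v → All (v ⊨_) (_ ∷ []) → v ⊨ (conj (_ ∷ []) ⇒' _)
      detach v (φ⇒ψ ∷ []) = from ⊨-⇒ λ φ-holds → to ⊨-⇒ φ⇒ψ (proj₁ (to ⊨-∧ φ-holds))

    mcs-not-both : ∀ {φ} → Γ ∋ φ → Γ ∋ (¬' φ) → ⊥
    mcs-not-both {φ} φ∈Γ ¬φ∈Γ = Γ-consistent (φ ∷ ¬' φ ∷ [] , φ∈Γ ∷ ¬φ∈Γ ∷ [] , ⊢-valid contradictory)
      where
      contradictory : ∀ v → v ⊨ ¬' conj (φ ∷ ¬' φ ∷ [])
      contradictory v = from ⊨-¬ λ both → refuted (to (⊨-conj (φ ∷ ¬' φ ∷ [])) both)
        where
        refuted : All (v ⊨_) (φ ∷ ¬' φ ∷ []) → ⊥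
        refuted (p ∷ ¬p ∷ []) = to ⊨-¬ ¬p p

    mcs-stable : ∀ {φ} → ¬ ¬ (Γ ∋ φ) → Γ ∋ φ
    mcs-stable nn = mcs-absorbs λ (M , M⊆ , ⊢¬M) →
      nn λ φ∈Γ → Γ-consistent (M , All.map (λ { (inj₁ ψ∈Γ) → ψ∈Γ ; (inj₂ refl) → φ∈Γ }) M⊆ , ⊢¬M)

    mcs-complete : ∀ {φ} → ¬ (Γ ∋ φ) → Γ ∋ (¬' φ)
    mcs-complete {φ} φ∉Γ = mcs-absorbs λ (M , M⊆ , ⊢¬M) →
      let (N , N⊆Γ , ⊢N⇒¬¬φ) = ∪-inconsistent M⊆ ⊢¬M
      in φ∉Γ (mcs-closed N⊆Γ (⊢-¬¬-elimʳ ⊢N⇒¬¬φ))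

  module Lindenbaum (stage : ℕ → List (Form n)) (enumerates : ∀ φ → ∃[ k ] φ ∈ stage k) where

    -- χ is added exactly when this keeps the set consistent; as membership is a
    -- proposition, no decision procedure for consistency is needed.
    extend : FSet {n} → Form n → FSet {n}
    extend Γ χ ψ = Γ ψ ⊎ (ψ ≡ χ × Consistent (Γ ∪｛ χ ｝))

    extendAll : List (Form n) → FSet {n} → FSet {n}
    extendAll []       Γ = Γ
    extendAll (χ ∷ χs) Γ = extendAll χs (extend Γ χ)

    chain : FSet {n} → ℕ → FSet {n}
    chain Σ₀ zero    = Σ₀
    chain Σ₀ (suc k) = extendAll (stage k) (chain Σ₀ k)

    limit : FSet {n} → FSet {n}
    limit Σ₀ ψ = ∃[ k ] chain Σ₀ k ψ

    extendAll-⊇ : ∀ χs Γ → Γ ⊆F extendAll χs Γ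
    extendAll-⊇ []       Γ ψ p = p
    extendAll-⊇ (χ ∷ χs) Γ ψ p = extendAll-⊇ χs (extend Γ χ) ψ (inj₁ p)

    extend-consistent : ∀ {Γ χ} → Consistent Γ → Consistent (extend Γ χ)
    extend-consistent {Γ} {χ} Γ-consistent (L , L⊆ , ⊢¬L) with classify L L⊆
      where
      classify : ∀ L → All (extend Γ χ) L → All Γ L ⊎ (Consistent (Γ ∪｛ χ ｝) × All (Γ ∪｛ χ ｝) L)
      classify []      []                 = inj₁ []
      classify (_ ∷ L) (inj₂ (refl , consistent) ∷ L⊆) =
        inj₂ (consistent , inj₂ refl ∷ All.map (λ { (inj₁ p) → inj₁ p ; (inj₂ (eq , _)) → inj₂ eq }) L⊆)
      classify (_ ∷ L) (inj₁ p ∷ L⊆) with classify L L⊆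
      ... | inj₁ L⊆Γ                 = inj₁ (p ∷ L⊆Γ)
      ... | inj₂ (consistent , L⊆Γχ) = inj₂ (consistent , inj₁ p ∷ L⊆Γχ)
    ... | inj₁ L⊆Γ                 = Γ-consistent (L , L⊆Γ , ⊢¬L)
    ... | inj₂ (consistent , L⊆Γχ) = consistent (L , L⊆Γχ , ⊢¬L)

    extendAll-consistent : ∀ χs {Γ} → Consistent Γ → Consistent (extendAll χs Γ)
    extendAll-consistent []       c = c
    extendAll-consistent (χ ∷ χs) c = extendAll-consistent χs (extend-consistent c)

    extendAll-maximal : ∀ {χs Γ χ} (Δ : FSet {n}) → χ ∈ χs →
                        extendAll χs Γ ⊆F Δ → Consistent Δ → Δ χ → extendAll χs Γ χ
    extendAll-maximal {χ ∷ χs} {Γ} Δ (here refl) ⊆Δ Δ-consistent χ∈Δ =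
      extendAll-⊇ χs (extend Γ χ) χ
        (inj₂ (refl , λ (L , L⊆ , ⊢¬L) → Δ-consistent (L , All.map into-Δ L⊆ , ⊢¬L)))
      where
      into-Δ : ∀ {ψ} → (Γ ∪｛ χ ｝) ψ → Δ ψ
      into-Δ (inj₁ p)    = ⊆Δ _ (extendAll-⊇ χs (extend Γ χ) _ (inj₁ p))
      into-Δ (inj₂ refl) = χ∈Δ
    extendAll-maximal {_ ∷ χs} Δ (there χ∈χs) = extendAll-maximal {χs} Δ χ∈χs

    chain-mono : ∀ Σ₀ {k m} → k ≤′ m → chain Σ₀ k ⊆F chain Σ₀ m
    chain-mono Σ₀ ≤′-refl        ψ p = p
    chain-mono Σ₀ (≤′-step {m} k≤m) ψ p = extendAll-⊇ (stage m) (chain Σ₀ m) ψ (chain-mono Σ₀ k≤m ψ p)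

    chain-consistent : ∀ {Σ₀} → Consistent Σ₀ → ∀ k → Consistent (chain Σ₀ k)
    chain-consistent c zero    = c
    chain-consistent c (suc k) = extendAll-consistent (stage k) (chain-consistent c k)

    limit-finite : ∀ Σ₀ L → All (limit Σ₀) L → ∃[ k ] All (chain Σ₀ k) L
    limit-finite Σ₀ []      []              = 0 , []
    limit-finite Σ₀ (ψ ∷ L) ((k , p) ∷ L⊆) with limit-finite Σ₀ L L⊆
    ... | m , L⊆chain = k ⊔ m , chain-mono Σ₀ (≤⇒≤′ (m≤m⊔n k m)) ψ p
                              ∷ All.map (chain-mono Σ₀ (≤⇒≤′ (m≤n⊔m k m)) _) L⊆chain

    limit-MCS : ∀ {Σ₀} → Consistent Σ₀ → IsMCS (limit Σ₀)
    limit-MCS {Σ₀} c = consistent , maximal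
      where
      consistent : Consistent (limit Σ₀)
      consistent (L , L⊆ , ⊢¬L) with limit-finite Σ₀ L L⊆
      ... | k , L⊆chain = chain-consistent c k (L , L⊆chain , ⊢¬L)
      maximal : ∀ Δ → limit Σ₀ ⊆F Δ → Consistent Δ → Δ ⊆F limit Σ₀
      maximal Δ ⊆Δ Δ-consistent χ χ∈Δ with enumerates χ
      ... | k , χ∈stage = suc k , extendAll-maximal Δ χ∈stage (λ ψ p → ⊆Δ ψ (suc k , p)) Δ-consistent χ∈Δ

    lindenbaum : ∀ {Σ₀} → Consistent Σ₀ → Σ[ Γ ∈ MCS {n} ] Σ₀ ⊆F proj₁ Γ
    lindenbaum {Σ₀} c = (limit Σ₀ , limit-MCS c) , λ ψ p → 0 , p

  mutual
    formsUpTo : ℕ → List (Form n)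
    formsUpTo zero    = []
    formsUpTo (suc k) = formsUpTo k ++ newForms k

    newForms : ℕ → List (Form n)
    newForms k = var k ∷ map ¬'_ fs ++ cartesianProductWith _∧'_ fs fs
                 ++ cartesianProductWith K (allFin n) fs ++ cartesianProductWith S (allFin n) fs
      where fs = formsUpTo k

  formsUpTo-mono : ∀ {k m φ} → k ≤′ m → φ ∈ formsUpTo k → φ ∈ formsUpTo m
  formsUpTo-mono ≤′-refl       p = p
  formsUpTo-mono (≤′-step k≤m) p = ∈-++⁺ˡ (formsUpTo-mono k≤m p)

  module _ {k : ℕ} where
    private
      fs : List (Form n)
      fs = formsUpTo k

      ∈-new : ∀ {φ} → φ ∈ newForms k → φ ∈ formsUpTo (suc k)
      ∈-new = ∈-++⁺ʳ fs

    var∈formsUpTo : var k ∈ formsUpTo (suc k)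
    var∈formsUpTo = ∈-new (here refl)

    ¬∈formsUpTo : ∀ {φ} → φ ∈ formsUpTo k → ¬' φ ∈ formsUpTo (suc k)
    ¬∈formsUpTo p = ∈-new (there (∈-++⁺ˡ (∈-map⁺ ¬'_ p)))

    ∧∈formsUpTo : ∀ {φ ψ} → φ ∈ formsUpTo k → ψ ∈ formsUpTo k → φ ∧' ψ ∈ formsUpTo (suc k)
    ∧∈formsUpTo p q = ∈-new (there (∈-++⁺ʳ (map ¬'_ fs) (∈-++⁺ˡ (∈-cartesianProductWith⁺ _∧'_ p q))))

    K∈formsUpTo : ∀ {a φ} → φ ∈ formsUpTo k → K a φ ∈ formsUpTo (suc k)
    K∈formsUpTo {a} p = ∈-new (there (∈-++⁺ʳ (map ¬'_ fs) (∈-++⁺ʳ (cartesianProductWith _∧'_ fs fs)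
      (∈-++⁺ˡ (∈-cartesianProductWith⁺ K (∈-allFin a) p)))))

    S∈formsUpTo : ∀ {a φ} → φ ∈ formsUpTo k → S a φ ∈ formsUpTo (suc k)
    S∈formsUpTo {a} p = ∈-new (there (∈-++⁺ʳ (map ¬'_ fs) (∈-++⁺ʳ (cartesianProductWith _∧'_ fs fs)
      (∈-++⁺ʳ (cartesianProductWith K (allFin n) fs) (∈-cartesianProductWith⁺ S (∈-allFin a) p)))))

  formsUpTo-complete : ∀ φ → ∃[ k ] φ ∈ formsUpTo k
  formsUpTo-complete (var p)  = suc p , var∈formsUpTo
  formsUpTo-complete (¬' φ) with formsUpTo-complete φ
  ... | k , p = suc k , ¬∈formsUpTo p
  formsUpTo-complete (φ ∧' ψ) with formsUpTo-complete φ | formsUpTo-complete ψ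
  ... | k , p | m , q = suc (k ⊔ m) , ∧∈formsUpTo (formsUpTo-mono (≤⇒≤′ (m≤m⊔n k m)) p)
                                                  (formsUpTo-mono (≤⇒≤′ (m≤n⊔m k m)) q)
  formsUpTo-complete (K a φ) with formsUpTo-complete φ
  ... | k , p = suc k , K∈formsUpTo p
  formsUpTo-complete (S a φ) with formsUpTo-complete φ
  ... | k , p = suc k , S∈formsUpTo p

  open Lindenbaum formsUpTo formsUpTo-complete using (lindenbaum) public

  SameClass : Fin n → MCS {n} → MCS {n} → Set₁
  SameClass a Γ Δ = ∀ Θ → R a Γ Θ ⇔ R a Δ Θ

  R-refl : ∀ a (Γ : MCS {n}) → R a Γ Γ
  R-refl a Γ φ Kφ∈Γ = mcs-⇒ Γ Kφ∈Γ (axT a φ)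

  -- Axiom 4 gives [Δ]_a ⊆ [Θ]_a; axiom 5 carries ¬K_a ψ from Θ to Δ for the converse.
  R⇒SameClass : ∀ {a} (Θ Δ : MCS {n}) → R a Θ Δ → SameClass a Θ Δ
  R⇒SameClass {a} Θ Δ ΘRΔ Ω = mk⇔
    (λ ΘRΩ ψ Kψ∈Δ → mcs-stable Ω λ ψ∉Ω →
       mcs-not-both Δ Kψ∈Δ (ΘRΔ _ (mcs-⇒ Θ (mcs-complete Θ (ψ∉Ω ∘ ΘRΩ ψ)) (ax5 a ψ))))
    (λ ΔRΩ ψ Kψ∈Θ → ΔRΩ ψ (ΘRΔ _ (mcs-⇒ Θ Kψ∈Θ (ax4 a ψ))))

  S-SameClass : ∀ {a φ} (Γ Δ : MCS {n}) → SameClass a Γ Δ → Γ ∋ S a φ → Δ ∋ S a φ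
  S-SameClass {a} {φ} Γ Δ same Sφ∈Γ = from (same Δ) (R-refl a Δ) (S a φ) (mcs-⇒ Γ Sφ∈Γ (axS4 a φ))

  ¬K-witness : ∀ (Θ : MCS {n}) {b φ} → Θ ∋ (¬' K b φ) → Σ[ Δ ∈ MCS {n} ] R b Θ Δ × Δ ∋ (¬' φ)
  ¬K-witness Θ {b} {φ} ¬Kφ∈Θ with lindenbaum consistent
    where
    consistent : Consistent ((λ ψ → Θ ∋ K b ψ) ∪｛ ¬' φ ｝)
    consistent (M , M⊆ , ⊢¬M) with ∪-inconsistent M⊆ ⊢¬M
    ... | N , KN⊆Θ , ⊢N⇒¬¬φ =
      mcs-not-both Θ (mcs-closed Θ (AllP.map⁺ KN⊆Θ) (⊢-K-conj b (⊢-¬¬-elimʳ ⊢N⇒¬¬φ))) ¬Kφ∈Θ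
  ... | Δ , ⊆Δ = Δ , (λ ψ Kψ∈Θ → ⊆Δ ψ (inj₁ Kψ∈Θ)) , ⊆Δ _ (inj₂ refl)

  some-MCS : MCS {n}
  some-MCS = proj₁ (lindenbaum ∅-consistent)

module CanonicalModel (n : ℕ) where
  open Canonical n

  infix 4 _∈c_ _⊆c_ _≅c_
  _∈c_ : CV → List CV → Set₁
  _∈c_ = _∈ₛ_ _≈c_

  _⊆c_ : List CV → List CV → Set₁
  _⊆c_ = _⊆ₛ_ _≈c_

  _≅c_ : List CV → List CV → Set₁
  _≅c_ = _≈ₛ_ _≈c_

  SameSet : MCS {n} → MCS {n} → Set
  SameSet Γ Δ = ∀ φ → (Γ ∋ φ) ⇔ (Δ ∋ φ)

  private
    module ⇔ {ℓ} = IsEquivalence (⇔-isEquivalence {ℓ})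

  ≈c-refl : ∀ {x} → x ≈c x
  ≈c-refl {starV Γ}  = star≈ (λ _ → ⇔.refl)
  ≈c-refl {agV a Γ}  = ag≈ (λ _ → ⇔.refl)

  ≈c-sym : ∀ {x y} → x ≈c y → y ≈c x
  ≈c-sym (star≈ e) = star≈ (⇔.sym ∘ e)
  ≈c-sym (ag≈ e)   = ag≈ (⇔.sym ∘ e)

  ≈c-trans : ∀ {x y z} → x ≈c y → y ≈c z → x ≈c z
  ≈c-trans (star≈ e) (star≈ f) = star≈ (λ φ → ⇔.trans (e φ) (f φ))
  ≈c-trans (ag≈ e)   (ag≈ f)   = ag≈ (λ Θ → ⇔.trans (e Θ) (f Θ))

  ≈c-isEquivalence : IsEquivalence _≈c_
  ≈c-isEquivalence = record { refl = ≈c-refl ; sym = ≈c-sym ; trans = ≈c-trans }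

  ∈c-resp : ∀ {x y X} → x ≈c y → y ∈c X → x ∈c X
  ∈c-resp x≈y = Any.map (≈c-trans x≈y)

  χc-resp : ∀ {x y} → x ≈c y → χc x ≡ χc y
  χc-resp (star≈ _) = refl
  χc-resp (ag≈ _)   = refl

  vertex : MCS {n} → Col n → CV
  vertex Γ ∗      = starV Γ
  vertex Γ (ag a) = agV a Γ

  χc-vertex : ∀ Γ c → χc (vertex Γ c) ≡ c
  χc-vertex Γ ∗      = refl
  χc-vertex Γ (ag a) = refl

  vertex∈Xs : ∀ Γ c → vertex Γ c ∈c Xs Γ
  vertex∈Xs Γ ∗      = here ≈c-refl
  vertex∈Xs Γ (ag a) = there (map⁺ (Any.map (λ { refl → ≈c-refl }) (∈-allFin a)))

  ∈-Xs⁻ : ∀ {x} Γ → x ∈c Xs Γ → x ≈c vertex Γ (χc x)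
  ∈-Xs⁻ {x} Γ (here x≈∗)  = subst (λ c → x ≈c vertex Γ c) (sym (χc-resp x≈∗)) x≈∗
  ∈-Xs⁻ {x} Γ (there x∈ag) with Any.satisfied (map⁻ x∈ag)
  ... | a , x≈a = subst (λ c → x ≈c vertex Γ c) (sym (χc-resp x≈a)) x≈a

  vertex-resp : ∀ {Γ Δ} → SameSet Γ Δ → ∀ c → vertex Γ c ≈c vertex Δ c
  vertex-resp Γ≐Δ ∗      = star≈ Γ≐Δ
  vertex-resp Γ≐Δ (ag a) = ag≈ λ Θ → mk⇔ (λ ΓRΘ φ Kφ∈Δ → ΓRΘ φ (from (Γ≐Δ (K a φ)) Kφ∈Δ))
                                         (λ ΔRΘ φ Kφ∈Γ → ΔRΘ φ (to (Γ≐Δ (K a φ)) Kφ∈Γ))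

  Xs-resp : ∀ {Γ Δ} → SameSet Γ Δ → Xs Γ ⊆c Xs Δ
  Xs-resp {Γ} {Δ} Γ≐Δ x x∈XΓ =
    ∈c-resp (≈c-trans (∈-Xs⁻ Γ x∈XΓ) (vertex-resp Γ≐Δ (χc x))) (vertex∈Xs Δ (χc x))

  Xs-face : ∀ Γ → Fc (Xs Γ)
  Xs-face Γ = (starV Γ , vertex∈Xs Γ ∗) , Γ , (λ _ x∈X → x∈X)

  IsFacetc : List CV → Set₁
  IsFacetc X = Fc X × (∀ Y → Fc Y → X ⊆c Y → Y ⊆c X)

  ≅Xs⇒facet : ∀ {X} Δ → X ≅c Xs Δ → IsFacetc X
  ≅Xs⇒facet {X} Δ (X⊆XΔ , XΔ⊆X) = ((starV Δ , XΔ⊆X _ (vertex∈Xs Δ ∗)) , Δ , X⊆XΔ) , maximal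
    where
    maximal : ∀ Y → Fc Y → X ⊆c Y → Y ⊆c X
    maximal Y (_ , Δ′ , Y⊆XΔ′) X⊆Y y y∈Y with ∈-Xs⁻ Δ′ (Y⊆XΔ′ _ (X⊆Y _ (XΔ⊆X _ (vertex∈Xs Δ ∗))))
    ... | star≈ Δ≐Δ′ = XΔ⊆X y (Xs-resp (⇔.sym ∘ Δ≐Δ′) y (Y⊆XΔ′ y y∈Y))

  Xs-facet : ∀ Γ → IsFacetc (Xs Γ)
  Xs-facet Γ = ≅Xs⇒facet Γ ((λ _ x∈X → x∈X) , (λ _ x∈X → x∈X))

  Fc-down : ∀ X Y → Fc X → Y ⊆c X → NonEmpty _≈c_ Y → Fc Y
  Fc-down X Y (_ , Γ , X⊆XΓ) Y⊆X Y-nonempty = Y-nonempty , Γ , λ y y∈Y → X⊆XΓ y (Y⊆X y y∈Y)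

  χc-injective : ∀ X → Fc X → ∀ x y → x ∈c X → y ∈c X → χc x ≡ χc y → x ≈c y
  χc-injective X (_ , Γ , X⊆XΓ) x y x∈X y∈X χx≡χy =
    ≈c-trans (∈-Xs⁻ Γ (X⊆XΓ x x∈X))
             (subst (λ c → vertex Γ c ≈c y) (sym χx≡χy) (≈c-sym (∈-Xs⁻ Γ (X⊆XΓ y y∈X))))

  facet-⊇Xs : ∀ {X Γ} → IsFacetc X → X ⊆c Xs Γ → Xs Γ ⊆c X
  facet-⊇Xs {Γ = Γ} (_ , maximal) = maximal (Xs Γ) (Xs-face Γ)

  facet-colours : ∀ X → IsFacetc X → ∀ c → Σ CV λ x → x ∈c X × χc x ≡ c
  facet-colours X facet@((_ , Γ , X⊆XΓ) , _) c =
    vertex Γ c , facet-⊇Xs facet X⊆XΓ _ (vertex∈Xs Γ c) , χc-vertex Γ c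

  vertex-in-facet : ∀ v → Σ (List CV) λ X → IsFacetc X × v ∈c X
  vertex-in-facet (starV Γ) = Xs Γ , Xs-facet Γ , vertex∈Xs Γ ∗
  vertex-in-facet (agV a Γ) = Xs Γ , Xs-facet Γ , vertex∈Xs Γ (ag a)

  νc-resp : ∀ X Y → IsFacetc X → IsFacetc Y → X ≅c Y → ∀ p → νc X p → νc Y p
  νc-resp X Y _ _ (X⊆Y , Y⊆X) p (Γ , (X⊆XΓ , XΓ⊆X) , p∈Γ) =
    Γ , ((λ y y∈Y → X⊆XΓ y (Y⊆X y y∈Y)) , (λ y y∈XΓ → X⊆Y y (XΓ⊆X y y∈XΓ))) , p∈Γ

  hat⇒facet : ∀ {φ X} → hat φ X → IsFacetc X
  hat⇒facet (Δ , X≅XΔ , _) = ≅Xs⇒facet Δ X≅XΔ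

  Xs∉hat : ∀ {φ} Δ → Δ ∋ (¬' φ) → ¬ hat φ (Xs Δ)
  Xs∉hat {φ} Δ ¬φ∈Δ (Δ′ , (XΔ⊆XΔ′ , _) , φ∈Δ′) with ∈-Xs⁻ Δ′ (XΔ⊆XΔ′ _ (vertex∈Xs Δ ∗))
  ... | star≈ Δ≐Δ′ = mcs-not-both Δ (from (Δ≐Δ′ φ) φ∈Δ′) ¬φ∈Δ

  Nc-resp : ∀ a v w → χc v ≡ ag a → v ≈c w → ∀ U → Nc a v U → Nc a w U
  Nc-resp a (agV a Γ) (agV a Δ) refl (ag≈ same) U (φ , Sφ∈Γ , U≐φ̂) =
    φ , S-SameClass Γ Δ same Sφ∈Γ , U≐φ̂

  Nc-facets : ∀ a v → χc v ≡ ag a → ∀ U → Nc a v U → ∀ X → U X → IsFacetc X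
  Nc-facets a (agV a Γ) refl U (φ , _ , U≐φ̂) X X∈U = hat⇒facet (to (U≐φ̂ X) X∈U)

  Nc-secrecy : ∀ a v → χc v ≡ ag a → ∀ U → Nc a v U → ∀ X → IsFacetc X → v ∈c X →
               ∀ b → b ≢ a →
               Σ (List CV) λ Y → IsFacetc Y × (Σ CV λ w → w ∈c X × w ∈c Y × χc w ≡ ag b) × ¬ U Y
  Nc-secrecy a (agV a Γ) refl U (φ , Sφ∈Γ , U≐φ̂) X facet@((_ , Θ , X⊆XΘ) , _) v∈X b b≢a
    with ∈-Xs⁻ Θ (X⊆XΘ _ v∈X)
  ... | ag≈ same with ¬K-witness Θ (mcs-⇒ Θ (S-SameClass Γ Θ same Sφ∈Γ) (axS2 a b φ (b≢a ∘ sym)))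
  ... | Δ , ΘRΔ , ¬φ∈Δ =
    Xs Δ , Xs-facet Δ ,
    (agV b Θ , facet-⊇Xs facet X⊆XΘ _ (vertex∈Xs Θ (ag b)) ,
               ∈c-resp (ag≈ (R⇒SameClass Θ Δ ΘRΔ)) (vertex∈Xs Δ (ag b)) , refl) ,
    Xs∉hat Δ ¬φ∈Δ ∘ to (U≐φ̂ (Xs Δ))

lemma5p14 : ∀ (n : ℕ) → 2 ≤ n →
              IsSecrecyModel n (Canonical.CV n) (Canonical._≈c_ n) (Canonical.Fc n)
                (Canonical.χc n) (Canonical.νc n) (Canonical.Nc n)
lemma5p14 n _ = record
  { ≈-equiv    = ≈c-isEquivalence
  ; F-nonempty = Xs some-MCS , Xs-face some-MCS
  ; F-faces    = λ X face → proj₁ face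
  ; F-down     = Fc-down
  ; χ-resp     = λ x y → χc-resp
  ; χ-inj      = χc-injective
  ; facet-cols = facet-colours
  ; vert-facet = vertex-in-facet
  ; ν-resp     = νc-resp
  ; N-resp     = Nc-resp
  ; N-facets   = Nc-facets
  ; SN         = Nc-secrecy
  }
  where
  open Canonical n
  open CanonicalModel n
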